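{- For every odd integer $m\ge 9$ and every odd integer $\Delta\ge m$, there exists an $m$-$\gamma_t$-critical graph $G$ of order $\Delta+m$ with maximum degree $\Delta(G)=\Delta$ and minimum degree $\delta(G)\ge 2$.
   Context: For a graph $G$, a set $S\subseteq V(G)$ is a total dominating set if every vertex of $G$ is adjacent to some vertex of $S$; $\gamma_t(G)$ is the minimum size of such a set. A leaf is a vertex of degree one. A graph $G$ with no isolated vertex is $\gamma_t$-critical if $\gamma_t(G-v)<\gamma_t(G)$ for every vertex $v$ not adjacent to a leaf, and $m$-$\gamma_t$-critical if also $\gamma_t(G)=m$. -}

module Defs where

open import Data.Nat using (ℕ; suc; _≤_; _<_; _*_; _+_)
open import Data.Bool using (Bool; true; false)
open import Data.Fin using (Fin; punchIn)
open import Data.Fin.Subset using (Subset; _∈_; ∣_∣)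
open import Data.Vec using (tabulate)
open import Data.Product using (Σ; ∃; _×_)
open import Relation.Binary.PropositionalEquality using (_≡_)
open import Relation.Nullary using (¬_)
open import Data.Unit using (⊤)

record Graph (n : ℕ) : Set where
  field
    adj   : Fin n → Fin n → Bool
    sym   : ∀ u v → adj u v ≡ adj v u
    irrefl : ∀ v → adj v v ≡ false
open Graph public

Adj : ∀ {n} → Graph n → Fin n → Fin n → Set
Adj G u v = adj G u v ≡ true

nbhd : ∀ {n} → Graph n → Fin n → Subset n
nbhd G v = tabulate (λ u → adj G v u)

deg : ∀ {n} → Graph n → Fin n → ℕ
deg G v = ∣ nbhd G v ∣

-- vertex deletion G - v (vertices of G - v are Fin k, embedded via punchIn v)
delete : ∀ {k} → Graph (suc k) → Fin (suc k) → Graph k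
delete G v = record
  { adj = λ a b → adj G (punchIn v a) (punchIn v b)
  ; sym = λ a b → sym G (punchIn v a) (punchIn v b)
  ; irrefl = λ a → irrefl G (punchIn v a) }

NoIsolated : ∀ {n} → Graph n → Set
NoIsolated G = ∀ v → ∃ λ u → Adj G v u

IsLeaf : ∀ {n} → Graph n → Fin n → Set
IsLeaf G v = deg G v ≡ 1

IsTDS : ∀ {n} → Graph n → Subset n → Set
IsTDS G S = ∀ v → ∃ λ u → u ∈ S × Adj G v u

γt≡ : ∀ {n} → Graph n → ℕ → Set
γt≡ G m = (Σ _ λ S → IsTDS G S × ∣ S ∣ ≡ m) × (∀ S → IsTDS G S → m ≤ ∣ S ∣)

γt< : ∀ {n} → Graph n → ℕ → Set
γt< G m = Σ _ λ S → IsTDS G S × ∣ S ∣ < m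

-- m-γ_t-critical: no isolated vertex, γ_t(G) = m, and
-- γ_t(G - v) < γ_t(G) for every v not adjacent to a leaf
-- (the order-0 case is vacuous: there are no vertices to delete)
DeletionCondition : ∀ {n} → ℕ → Graph n → Set
DeletionCondition {ℕ.zero} m G = ⊤
DeletionCondition {suc k} m G =
  ∀ v → ¬ (∃ λ u → Adj G v u × IsLeaf G u) → γt< (delete G v) m

mγtCritical : ∀ {n} → ℕ → Graph n → Set
mγtCritical m G = NoIsolated G × γt≡ G m × DeletionCondition m G

MaxDegree : ∀ {n} → Graph n → ℕ → Set
MaxDegree G Δ = (∀ v → deg G v ≤ Δ) × (∃ λ v → deg G v ≡ Δ)

MinDegree≥ : ∀ {n} → Graph n → ℕ → Set
MinDegree≥ G d = ∀ v → d ≤ deg G v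

Odd : ℕ → Set
Odd m = ∃ λ k → m ≡ suc (2 * k)

-- For m = 2J + 1 and Δ = 2J + 2t + 1 (J ≥ 4) the graph has a hub X, 2J rung vertices R s i
-- (s : Bool, i < J) forming the perfect matching R false i ─ R true i, and vertices hanging on the
-- rungs: A s i on R s i, C on R true 0 and E s u (u < t) on R s 1.  The hub is adjacent to every
-- vertex except the rungs; further edges join A false 0, A true 0 and C to the A s 1, A s 2 and
-- A s 3 respectively, A false 0 to every E s u, A s 1 to every E (not s) u, and E false u to
-- E true u′ for u ≢ u′.
--
-- Every vertex other than X has exactly one rung neighbour, its foot, so a total dominating set
-- contains 2J distinct dominators of the rungs.  Chasing the dominators of X, A true 0, C, …
-- shows that it always contains one vertex more, and the rungs together with C form a total
-- dominating set of size 2J + 1.  For each vertex x, exchanging one, two or four rungs for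
-- neighbours of the vertices they dominated gives a total dominating set of size 2J of G - x.
-- The hub has degree Δ, every other vertex at most 8 + 2t ≤ Δ.

module Submission where

open import Defs hiding (sym)
open import Data.Nat using (ℕ; zero; suc; _+_; _*_; _≤_; _<_; z≤n; s≤s)
open import Data.Nat.Properties
  using ( module ≤-Reasoning; ≤-antisym; ≤-trans; ≤-reflexive; ≤-pred; n≤1+n; m≤m+n; m≤n⇒∃[o]m+o≡n
        ; +-mono-≤; +-monoʳ-≤; +-assoc; +-comm; +-suc; +-identityʳ; *-cancelˡ-≤ )
open import Data.Bool using (Bool; true; false; _∧_; _∨_; not)
open import Data.Bool.Properties using (not-involutive; ∨-comm; ∨-zeroʳ; ∧-zeroʳ; ∧-identityʳ)
open import Data.Fin using (Fin; zero; suc; _↑ˡ_; _↑ʳ_; splitAt; punchIn; punchOut; _≟_)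
open import Data.Fin.Properties
  using ( suc-injective; 0≢1+n; splitAt-↑ˡ; splitAt-↑ʳ; splitAt⁻¹-↑ˡ; splitAt⁻¹-↑ʳ
        ; punchIn-injective; punchInᵢ≢i; punchIn-punchOut )
open import Data.Fin.Patterns using (0F; 1F; 2F; 3F)
open import Data.Fin.Subset using (Subset; ∣_∣)
open import Data.Vec using (tabulate; lookup)
open import Data.Vec.Properties using (lookup∘tabulate; lookup⇒[]=; []=⇒lookup; tabulate∘lookup)
open import Data.Sum using (_⊎_; inj₁; inj₂; [_,_]′; swap)
open import Data.Product using (Σ; ∃; ∃₂; _×_; _,_; proj₁; proj₂)
open import Data.Empty using (⊥-elim)
open import Data.Nat.Tactic.RingSolver using (solve-∀)
open import Function using (_∘_; const; id)
open import Function.Definitions using (Injective)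
open import Relation.Binary.PropositionalEquality hiding (J)
open import Relation.Nullary using (¬_; does; yes; no)
open import Relation.Nullary.Decidable using (dec-true; dec-false; map′)
open import Relation.Binary.Definitions using (DecidableEquality)

private variable
  a b n : ℕ

-- Counting Boolean predicates on Fin n

fromBool : Bool → ℕ
fromBool true  = 1
fromBool false = 0

count : (Fin n → Bool) → ℕ
count {zero}  f = 0
count {suc n} f = fromBool (f zero) + count (f ∘ suc)

∣tabulate∣≡count : (f : Fin n → Bool) → ∣ tabulate f ∣ ≡ count f
∣tabulate∣≡count {zero}  f = refl
∣tabulate∣≡count {suc n} f with f zero
... | true  = cong suc (∣tabulate∣≡count (f ∘ suc))
... | false = ∣tabulate∣≡count (f ∘ suc)

count-cong : {f g : Fin n → Bool} → (∀ i → f i ≡ g i) → count f ≡ count g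
count-cong {zero}  f≗g = refl
count-cong {suc n} f≗g = cong₂ _+_ (cong fromBool (f≗g zero)) (count-cong (f≗g ∘ suc))

count-const-false : count {n} (const false) ≡ 0
count-const-false {zero}  = refl
count-const-false {suc n} = count-const-false {n}

count-const-true : count {n} (const true) ≡ n
count-const-true {zero}  = refl
count-const-true {suc n} = cong suc (count-const-true {n})

count-++ : (f : Fin (a + b) → Bool) → count f ≡ count (f ∘ (_↑ˡ b)) + count (f ∘ (a ↑ʳ_))
count-++ {zero}  f = refl
count-++ {suc a} f = trans (cong (fromBool (f zero) +_) (count-++ {a} (f ∘ suc))) (sym (+-assoc (fromBool (f zero)) _ _))

count-[,]′ : ∀ {A : Set} (f : A → Bool) (g : Fin a → A) (h : Fin b → A) →
             count (f ∘ [ g , h ]′ ∘ splitAt a) ≡ count (f ∘ g) + count (f ∘ h)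
count-[,]′ {a} {b} f g h = trans (count-++ {a} (f ∘ [ g , h ]′ ∘ splitAt a))
  (cong₂ _+_ (count-cong (λ i → cong (f ∘ [ g , h ]′) (splitAt-↑ˡ a i b)))
             (count-cong (λ i → cong (f ∘ [ g , h ]′) (splitAt-↑ʳ a b i))))

count-∨ : (f g : Fin n → Bool) → count (λ i → f i ∨ g i) ≤ count f + count g
count-∨ {zero}  f g = z≤n
count-∨ {suc n} f g with f zero | g zero
... | true  | true  = s≤s (≤-trans (count-∨ (f ∘ suc) (g ∘ suc)) (+-monoʳ-≤ _ (n≤1+n _)))
... | true  | false = s≤s (count-∨ (f ∘ suc) (g ∘ suc))
... | false | true  = ≤-trans (s≤s (count-∨ (f ∘ suc) (g ∘ suc))) (≤-reflexive (sym (+-suc _ _)))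
... | false | false = count-∨ (f ∘ suc) (g ∘ suc)

count-≟ : (k : Fin n) → count (λ i → does (i ≟ k)) ≡ 1
count-≟ {suc n} zero    = cong suc (count-const-false {n})
count-≟ {suc n} (suc k) = count-≟ k

count-remove : {f : Fin n → Bool} (k : Fin n) → f k ≡ true →
               count f ≡ suc (count (λ i → f i ∧ not (does (i ≟ k))))
count-remove {suc n} {f} zero    fk rewrite fk = cong suc (count-cong (λ i → sym (∧-identityʳ (f (suc i)))))
count-remove {suc n} {f} (suc k) fk with f zero
... | true  = cong suc (count-remove k fk)
... | false = count-remove k fk

count-injection : (h : Fin a → Fin b) {f : Fin a → Bool} {g : Fin b → Bool} →
                  (∀ i → f i ≡ true → g (h i) ≡ true) →
                  (∀ {i j} → f i ≡ true → f j ≡ true → h i ≡ h j → i ≡ j) → count f ≤ count g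
count-injection {zero}  h f⇒g h-inj = z≤n
count-injection {suc a} h {f} {g} f⇒g h-inj with f zero in f₀
... | false = count-injection (h ∘ suc) (f⇒g ∘ suc) (λ fi fj → suc-injective ∘ h-inj fi fj)
... | true  = ≤-trans (s≤s (count-injection (h ∘ suc) f⇒g′ (λ fi fj → suc-injective ∘ h-inj fi fj)))
                      (≤-reflexive (sym (count-remove (h zero) (f⇒g zero f₀))))
  where
  f⇒g′ : ∀ i → f (suc i) ≡ true → g (h (suc i)) ∧ not (does (h (suc i) ≟ h zero)) ≡ true
  f⇒g′ i fi rewrite f⇒g (suc i) fi | dec-false (h (suc i) ≟ h zero) (λ e → 0≢1+n (sym (h-inj fi f₀ e))) = refl

count-mono : {f g : Fin n → Bool} → (∀ i → f i ≡ true → g i ≡ true) → count f ≤ count g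
count-mono f⊆g = count-injection id f⊆g (λ _ _ → id)

pairs : ∀ {B : Set} → (Bool → Fin a → B) → Fin (a + a) → B
pairs {a} g = [ g false , g true ]′ ∘ splitAt a

count-pairs : ∀ {B : Set} (f : B → Bool) (g : Bool → Fin a → B) →
              count (f ∘ pairs g) ≡ count (f ∘ g false) + count (f ∘ g true)
count-pairs f g = count-[,]′ f (g false) (g true)

count-pairs-true : ∀ {B : Set} (f : B → Bool) (g : Bool → Fin a → B) → (∀ s i → f (g s i) ≡ true) →
                   count (f ∘ pairs g) ≡ a + a
count-pairs-true {a} f g fg = trans (count-pairs f g)
  (cong₂ _+_ (trans (count-cong (fg false)) (count-const-true {a}))
             (trans (count-cong (fg true)) (count-const-true {a})))

count-pairs-false : ∀ {B : Set} (f : B → Bool) (g : Bool → Fin a → B) → (∀ s i → f (g s i) ≡ false) →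
                    count (f ∘ pairs g) ≡ 0
count-pairs-false {a} f g fg = trans (count-pairs f g)
  (cong₂ _+_ (trans (count-cong (fg false)) (count-const-false {a}))
             (trans (count-cong (fg true)) (count-const-false {a})))

tabulate-IsTDS : (G : Graph n) (T : Fin n → Bool) →
                 (∀ u → ∃ λ w → T w ≡ true × Adj G u w) → IsTDS G (tabulate T)
tabulate-IsTDS G T dom u with w , Tw , uw ← dom u =
  w , lookup⇒[]= w (tabulate T) (trans (lookup∘tabulate T w) Tw) , uw

delete-γt< : (G : Graph (suc n)) (v : Fin (suc n)) (T : Fin (suc n) → Bool) → T v ≡ false →
             (∀ u → u ≢ v → ∃ λ w → T w ≡ true × Adj G u w) →
             ∀ {m} → count T < m → γt< (delete G v) m
delete-γt< G v T Tv dom T<m = tabulate (T ∘ punchIn v) , tds , ≤-trans (s≤s size) T<m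
  where
  T-avoids-v : ∀ {w} → T w ≡ true → v ≢ w
  T-avoids-v Tw refl with () ← trans (sym Tw) Tv
  tds : IsTDS (delete G v) (tabulate (T ∘ punchIn v))
  tds = tabulate-IsTDS (delete G v) (T ∘ punchIn v) λ a →
    let w , Tw , aw = dom (punchIn v a) (punchInᵢ≢i v a)
        back = sym (punchIn-punchOut (T-avoids-v Tw))
    in punchOut (T-avoids-v Tw) , subst (λ x → T x ≡ true) back Tw , subst (Adj G (punchIn v a)) back aw
  size : ∣ tabulate (T ∘ punchIn v) ∣ ≤ count T
  size = ≤-trans (≤-reflexive (∣tabulate∣≡count (T ∘ punchIn v)))
                 (count-injection (punchIn v) {g = T} (λ _ p → p) (λ _ _ → punchIn-injective v _ _))

2≤deg : (G : Graph n) {v w w′ : Fin n} → w ≢ w′ → Adj G v w → Adj G v w′ → 2 ≤ deg G v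
2≤deg G {v} {w} {w′} w≢w′ vw vw′ = subst (2 ≤_) (sym (∣tabulate∣≡count (adj G v)))
  (count-injection pick {const true} (λ { 0F _ → vw ; 1F _ → vw′ }) (λ _ _ → pick-injective))
  where
  pick : Fin 2 → Fin _
  pick 0F = w
  pick 1F = w′
  pick-injective : Injective _≡_ _≡_ pick
  pick-injective {0F} {0F} _ = refl
  pick-injective {0F} {1F} e = ⊥-elim (w≢w′ e)
  pick-injective {1F} {0F} e = ⊥-elim (w≢w′ (sym e))
  pick-injective {1F} {1F} _ = refl

module Enumeration {V : Set} {n : ℕ} (dec : Fin n → V) (enc : V → Fin n)
                   (dec∘enc : ∀ v → dec (enc v) ≡ v) (enc∘dec : ∀ i → enc (dec i) ≡ i) where

  enc-injective : Injective _≡_ _≡_ enc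
  enc-injective {v} {w} e = trans (sym (dec∘enc v)) (trans (cong dec e) (dec∘enc w))

  dec-injective : Injective _≡_ _≡_ dec
  dec-injective {i} {j} e = trans (sym (enc∘dec i)) (trans (cong enc e) (enc∘dec j))

  _≟ᵛ_ : DecidableEquality V
  v ≟ᵛ w = map′ enc-injective (cong enc) (enc v ≟ enc w)

  infix 4 _∈ᵛ_
  _∈ᵛ_ : V → (V → Bool) → Set
  v ∈ᵛ f = f v ≡ true

  countᵛ : (V → Bool) → ℕ
  countᵛ f = count (f ∘ dec)

  countᵛ-mono : {f g : V → Bool} → (∀ v → v ∈ᵛ f → v ∈ᵛ g) → countᵛ f ≤ countᵛ g
  countᵛ-mono f⊆g = count-mono (f⊆g ∘ dec)

  countᵛ-injection : (h : V → V) {f g : V → Bool} → (∀ v → v ∈ᵛ f → h v ∈ᵛ g) →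
                     (∀ {v w} → v ∈ᵛ f → w ∈ᵛ f → h v ≡ h w → v ≡ w) → countᵛ f ≤ countᵛ g
  countᵛ-injection h {f} {g} f⇒g h-inj = count-injection (enc ∘ h ∘ dec) {g = g ∘ dec}
    (λ i fi → subst (λ v → g v ≡ true) (sym (dec∘enc (h (dec i)))) (f⇒g (dec i) fi))
    (λ fi fj → dec-injective ∘ h-inj fi fj ∘ enc-injective)

  -- Opaque, so that the implicit arguments of the lemmas below can be inferred from goals
  -- such as w ∈ᵛ replace r x (replace r′ x′ f).
  opaque
    remove : V → (V → Bool) → V → Bool
    remove r f w = f w ∧ not (does (w ≟ᵛ r))

    insert : V → (V → Bool) → V → Bool
    insert x f w = f w ∨ does (w ≟ᵛ x)

  opaque
    unfolding remove insert

    remove-keep : ∀ {r f w} → w ∈ᵛ f → w ≢ r → w ∈ᵛ remove r f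
    remove-keep w∈f w≢r rewrite w∈f | dec-false (_ ≟ᵛ _) w≢r = refl

    remove-absent : ∀ {r f w} → f w ≡ false → remove r f w ≡ false
    remove-absent w∉f rewrite w∉f = refl

    remove-old : ∀ {r f} → remove r f r ≡ false
    remove-old {r} {f} rewrite dec-true (r ≟ᵛ r) refl = ∧-zeroʳ (f r)

    insert-new : ∀ {x f} → x ∈ᵛ insert x f
    insert-new {x} {f} rewrite dec-true (x ≟ᵛ x) refl = ∨-zeroʳ (f x)

    insert-keep : ∀ {x f w} → w ∈ᵛ f → w ∈ᵛ insert x f
    insert-keep w∈f rewrite w∈f = refl

    insert-absent : ∀ {x f w} → f w ≡ false → w ≢ x → insert x f w ≡ false
    insert-absent w∉f w≢x rewrite w∉f | dec-false (_ ≟ᵛ _) w≢x = refl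

    countᵛ-remove : ∀ {r f} → r ∈ᵛ f → countᵛ f ≡ suc (countᵛ (remove r f))
    countᵛ-remove {r} {f} r∈f = trans (count-remove (enc r) (trans (cong f (dec∘enc r)) r∈f))
      (cong suc (count-cong (λ i → cong (λ j → f (dec i) ∧ not (does (j ≟ enc r))) (sym (enc∘dec i)))))

    countᵛ-insert : ∀ x f → countᵛ (insert x f) ≤ suc (countᵛ f)
    countᵛ-insert x f = begin
      countᵛ (insert x f)                          ≤⟨ count-∨ (f ∘ dec) (λ i → does (dec i ≟ᵛ x)) ⟩
      countᵛ f + count (λ i → does (dec i ≟ᵛ x))
        ≡⟨ cong (countᵛ f +_) (trans (count-cong (λ i → cong (λ j → does (j ≟ enc x)) (enc∘dec i)))
                                     (count-≟ (enc x))) ⟩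
      countᵛ f + 1                                 ≡⟨ +-comm _ 1 ⟩
      suc (countᵛ f)                               ∎
      where open ≤-Reasoning

  replace : V → V → (V → Bool) → V → Bool
  replace r x = insert x ∘ remove r

  module _ {r x : V} {f : V → Bool} where

    replace-new : x ∈ᵛ replace r x f
    replace-new = insert-new

    replace-keep : ∀ {w} → w ∈ᵛ f → w ≢ r → w ∈ᵛ replace r x f
    replace-keep w∈f w≢r = insert-keep (remove-keep w∈f w≢r)

    replace-absent : ∀ {w} → f w ≡ false → w ≢ x → replace r x f w ≡ false
    replace-absent w∉f = insert-absent (remove-absent w∉f)

    replace-old : r ≢ x → replace r x f r ≡ false
    replace-old = insert-absent remove-old

    countᵛ-replace : r ∈ᵛ f → countᵛ (replace r x f) ≤ countᵛ f
    countᵛ-replace r∈f = ≤-trans (countᵛ-insert x (remove r f)) (≤-reflexive (sym (countᵛ-remove r∈f)))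

  module WithAdjacency (adjᵛ : V → V → Bool) (adjᵛ-sym : ∀ v w → adjᵛ v w ≡ adjᵛ w v)
           (adjᵛ-irrefl : ∀ v → adjᵛ v v ≡ false) where

    graph : Graph n
    graph = record
      { adj    = λ i j → adjᵛ (dec i) (dec j)
      ; sym    = λ i j → adjᵛ-sym (dec i) (dec j)
      ; irrefl = λ i → adjᵛ-irrefl (dec i) }

    deg-graph : ∀ i → deg graph i ≡ countᵛ (adjᵛ (dec i))
    deg-graph i = ∣tabulate∣≡count (adj graph i)

    Dominated : (V → Bool) → V → Set
    Dominated T u = ∃ λ w → w ∈ᵛ T × adjᵛ u w ≡ true

    adjᵛ⇒Adj : ∀ {i w} → adjᵛ (dec i) w ≡ true → Adj graph i (enc w)
    adjᵛ⇒Adj {i} {w} = subst (λ v → adjᵛ (dec i) v ≡ true) (sym (dec∘enc w))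

    Dominated⇒Adj : ∀ {T i} → Dominated T (dec i) → ∃ λ j → T (dec j) ≡ true × Adj graph i j
    Dominated⇒Adj {T} (w , Tw , uw) = enc w , subst (λ v → T v ≡ true) (sym (dec∘enc w)) Tw , adjᵛ⇒Adj uw

    tabulate-IsTDSᵛ : (T : V → Bool) → (∀ u → Dominated T u) → IsTDS graph (tabulate (T ∘ dec))
    tabulate-IsTDSᵛ T dom = tabulate-IsTDS graph (T ∘ dec) (Dominated⇒Adj ∘ dom ∘ dec)

    IsTDS⇒Dominated : ∀ {S} → IsTDS graph S → ∀ u → Dominated (lookup S ∘ enc) u
    IsTDS⇒Dominated {S} tds u with j , j∈S , uj ← tds (enc u) =
      dec j , trans (cong (lookup S) (enc∘dec j)) ([]=⇒lookup j∈S)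
            , subst (λ v → adjᵛ v (dec j) ≡ true) (dec∘enc u) uj

    ∣S∣≡countᵛ : (S : Subset n) → ∣ S ∣ ≡ countᵛ (lookup S ∘ enc)
    ∣S∣≡countᵛ S = trans (cong ∣_∣ (sym (tabulate∘lookup S))) (trans (∣tabulate∣≡count (lookup S))
                         (count-cong (λ i → cong (lookup S) (sym (enc∘dec i)))))

encode-[,]′∘splitAt : ∀ {B : Set} (e : Fin (a + b) → Fin n) (code : B → Fin n)
                      (g : Fin a → B) (h : Fin b → B) →
                      (∀ j → code (g j) ≡ e (j ↑ˡ b)) → (∀ j → code (h j) ≡ e (a ↑ʳ j)) →
                      ∀ i → code ([ g , h ]′ (splitAt a i)) ≡ e i
encode-[,]′∘splitAt {a} e code g h g-code h-code i with splitAt a i in eq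
... | inj₁ j = trans (g-code j) (cong e (splitAt⁻¹-↑ˡ eq))
... | inj₂ j = trans (h-code j) (cong e (splitAt⁻¹-↑ʳ eq))

-- The construction

module Construction (k t : ℕ) where

  J : ℕ
  J = 4 + k

  data V : Set where
    X   : V
    R A : Bool → Fin J → V
    C   : V
    E   : Bool → Fin t → V

  N₃ N₂ N₁ N : ℕ
  N₃ = 1 + (t + t)
  N₂ = (J + J) + N₃
  N₁ = (J + J) + N₂
  N  = 1 + N₁

  dec₃ : Fin N₃ → V
  dec₃ = [ const C , pairs E ]′ ∘ splitAt 1
  dec₂ : Fin N₂ → V
  dec₂ = [ pairs A , dec₃ ]′ ∘ splitAt (J + J)
  dec₁ : Fin N₁ → V
  dec₁ = [ pairs R , dec₂ ]′ ∘ splitAt (J + J)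
  dec : Fin N → V
  dec = [ const X , dec₁ ]′ ∘ splitAt 1

  ι₁ : Fin N₁ → Fin N
  ι₁ = 1 ↑ʳ_
  ι₂ : Fin N₂ → Fin N
  ι₂ = ι₁ ∘ ((J + J) ↑ʳ_)
  ι₃ : Fin N₃ → Fin N
  ι₃ = ι₂ ∘ ((J + J) ↑ʳ_)

  enc : V → Fin N
  enc X           = zero
  enc (R false i) = ι₁ ((i ↑ˡ J) ↑ˡ N₂)
  enc (R true  i) = ι₁ ((J ↑ʳ i) ↑ˡ N₂)
  enc (A false i) = ι₂ ((i ↑ˡ J) ↑ˡ N₃)
  enc (A true  i) = ι₂ ((J ↑ʳ i) ↑ˡ N₃)
  enc C           = ι₃ zero
  enc (E false u) = ι₃ (1 ↑ʳ (u ↑ˡ t))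
  enc (E true  u) = ι₃ (1 ↑ʳ (t ↑ʳ u))

  enc∘dec₃ : ∀ i → enc (dec₃ i) ≡ ι₃ i
  enc∘dec₃ = encode-[,]′∘splitAt ι₃ enc (const C) (pairs E) (λ { zero → refl })
               (encode-[,]′∘splitAt (ι₃ ∘ (1 ↑ʳ_)) enc (E false) (E true) (λ _ → refl) (λ _ → refl))

  enc∘dec₂ : ∀ i → enc (dec₂ i) ≡ ι₂ i
  enc∘dec₂ = encode-[,]′∘splitAt ι₂ enc (pairs A) dec₃
               (encode-[,]′∘splitAt (ι₂ ∘ (_↑ˡ N₃)) enc (A false) (A true) (λ _ → refl) (λ _ → refl)) enc∘dec₃

  enc∘dec₁ : ∀ i → enc (dec₁ i) ≡ ι₁ i
  enc∘dec₁ = encode-[,]′∘splitAt ι₁ enc (pairs R) dec₂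
               (encode-[,]′∘splitAt (ι₁ ∘ (_↑ˡ N₂)) enc (R false) (R true) (λ _ → refl) (λ _ → refl)) enc∘dec₂

  enc∘dec : ∀ i → enc (dec i) ≡ i
  enc∘dec = encode-[,]′∘splitAt id enc (const X) dec₁ (λ { zero → refl }) enc∘dec₁

  dec∘enc : ∀ v → dec (enc v) ≡ v
  dec∘enc X = refl
  dec∘enc (R false i) rewrite splitAt-↑ˡ (J + J) (i ↑ˡ J) N₂ | splitAt-↑ˡ J i J = refl
  dec∘enc (R true  i) rewrite splitAt-↑ˡ (J + J) (J ↑ʳ i) N₂ | splitAt-↑ʳ J J i = refl
  dec∘enc (A false i) rewrite splitAt-↑ʳ (J + J) N₂ ((i ↑ˡ J) ↑ˡ N₃)
                            | splitAt-↑ˡ (J + J) (i ↑ˡ J) N₃ | splitAt-↑ˡ J i J = refl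
  dec∘enc (A true  i) rewrite splitAt-↑ʳ (J + J) N₂ ((J ↑ʳ i) ↑ˡ N₃)
                            | splitAt-↑ˡ (J + J) (J ↑ʳ i) N₃ | splitAt-↑ʳ J J i = refl
  dec∘enc C           rewrite splitAt-↑ʳ (J + J) N₂ ((J + J) ↑ʳ zero) | splitAt-↑ʳ (J + J) N₃ zero = refl
  dec∘enc (E false u) rewrite splitAt-↑ʳ (J + J) N₂ ((J + J) ↑ʳ suc (u ↑ˡ t))
                            | splitAt-↑ʳ (J + J) N₃ (suc (u ↑ˡ t)) | splitAt-↑ˡ t u t = refl
  dec∘enc (E true  u) rewrite splitAt-↑ʳ (J + J) N₂ ((J + J) ↑ʳ suc (t ↑ʳ u))
                            | splitAt-↑ʳ (J + J) N₃ (suc (t ↑ʳ u)) | splitAt-↑ʳ t t u = refl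

  open Enumeration dec enc dec∘enc enc∘dec

  countᵛ-split : ∀ f → countᵛ f ≡ fromBool (f X) + (count (f ∘ pairs R) + (count (f ∘ pairs A)
                                  + (fromBool (f C) + count (f ∘ pairs E))))
  countᵛ-split f =
    trans (count-[,]′ {1} f (const X) dec₁) (cong₂ _+_ (+-identityʳ (fromBool (f X)))
    (trans (count-[,]′ {J + J} f (pairs R) dec₂) (cong (count (f ∘ pairs R) +_)
    (trans (count-[,]′ {J + J} f (pairs A) dec₃) (cong (count (f ∘ pairs A) +_)
    (trans (count-[,]′ {1} f (const C) (pairs E))
           (cong (_+ count (f ∘ pairs E)) (+-identityʳ (fromBool (f C))))))))))

  data Edge : V → V → Set where
    X─A   : ∀ s i → Edge X (A s i)
    X─C   : Edge X C
    X─E   : ∀ s u → Edge X (E s u)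
    R─R   : ∀ i → Edge (R false i) (R true i)
    A─R   : ∀ s i → Edge (A s i) (R s i)
    C─R   : Edge C (R true 0F)
    E─R   : ∀ s u → Edge (E s u) (R s 1F)
    A₀─A₁ : ∀ s → Edge (A false 0F) (A s 1F)
    A₀─E  : ∀ s u → Edge (A false 0F) (E s u)
    A₁─E  : ∀ u → Edge (A false 1F) (E true u)
    A₀′─A₂ : ∀ s → Edge (A true 0F) (A s 2F)
    C─A₃  : ∀ s → Edge C (A s 3F)
    E─A₁′  : ∀ u → Edge (E false u) (A true 1F)
    E─E   : ∀ {u w} → u ≢ w → Edge (E false u) (E true w)

  infix 4 _~_
  _~_ : V → V → Set
  v ~ w = Edge v w ⊎ Edge w v

  ~-sym : ∀ {v w} → v ~ w → w ~ v
  ~-sym = swap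

  edge : V → V → Bool
  edge X            (A _ _)      = true
  edge X            C            = true
  edge X            (E _ _)      = true
  edge (R false i)  (R true j)   = does (i ≟ j)
  edge (A false i)  (R false j)  = does (i ≟ j)
  edge (A true i)   (R true j)   = does (i ≟ j)
  edge (A false 0F) (A _ 1F)     = true
  edge (A false 0F) (E _ _)      = true
  edge (A false 1F) (E true _)   = true
  edge (A true 0F)  (A _ 2F)     = true
  edge C            (R true 0F)  = true
  edge C            (A _ 3F)     = true
  edge (E false _)  (R false 1F) = true
  edge (E true _)   (R true 1F)  = true
  edge (E false _)  (A true 1F)  = true
  edge (E false u)  (E true w)   = not (does (u ≟ w))
  edge _            _            = false

  edge-complete : ∀ {v w} → Edge v w → edge v w ≡ true
  edge-complete (X─A s i)     = refl
  edge-complete X─C           = refl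
  edge-complete (X─E s u)     = refl
  edge-complete (R─R i)       = dec-true (i ≟ i) refl
  edge-complete (A─R false i) = dec-true (i ≟ i) refl
  edge-complete (A─R true i)  = dec-true (i ≟ i) refl
  edge-complete C─R           = refl
  edge-complete (E─R false u) = refl
  edge-complete (E─R true u)  = refl
  edge-complete (A₀─A₁ s)     = refl
  edge-complete (A₀─E s u)    = refl
  edge-complete (A₁─E u)      = refl
  edge-complete (A₀′─A₂ s)    = refl
  edge-complete (C─A₃ s)      = refl
  edge-complete (E─A₁′ u)     = refl
  edge-complete (E─E u≢w)     = cong not (dec-false (_ ≟ _) u≢w)

  edge-sound : ∀ v w → edge v w ≡ true → Edge v w
  edge-sound X (A s i) _ = X─A s i
  edge-sound X C       _ = X─C
  edge-sound X (E s u) _ = X─E s u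
  edge-sound (R false i) (R true j) h with i ≟ j | h
  ... | yes refl | _ = R─R i
  edge-sound (A false i) (R false j) h with i ≟ j | h
  ... | yes refl | _ = A─R false i
  edge-sound (A true i) (R true j) h with i ≟ j | h
  ... | yes refl | _ = A─R true i
  edge-sound (A false 0F) (A s 1F)     _ = A₀─A₁ s
  edge-sound (A false 0F) (E s u)      _ = A₀─E s u
  edge-sound (A false 1F) (E true u)   _ = A₁─E u
  edge-sound (A true 0F)  (A s 2F)     _ = A₀′─A₂ s
  edge-sound C            (R true 0F)  _ = C─R
  edge-sound C            (A s 3F)     _ = C─A₃ s
  edge-sound (E false u)  (R false 1F) _ = E─R false u
  edge-sound (E true u)   (R true 1F)  _ = E─R true u
  edge-sound (E false u)  (A true 1F)  _ = E─A₁′ u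
  edge-sound (E false u)  (E true w) h with u ≟ w | h
  ... | no u≢w | _ = E─E u≢w

  adjᵛ : V → V → Bool
  adjᵛ v w = edge v w ∨ edge w v

  adjᵛ-sym : ∀ v w → adjᵛ v w ≡ adjᵛ w v
  adjᵛ-sym v w = ∨-comm (edge v w) (edge w v)

  adjᵛ-irrefl : ∀ v → adjᵛ v v ≡ false
  adjᵛ-irrefl X                 = refl
  adjᵛ-irrefl (R false i)       = refl
  adjᵛ-irrefl (R true i)        = refl
  adjᵛ-irrefl (A false 0F)      = refl
  adjᵛ-irrefl (A false (suc i)) = refl
  adjᵛ-irrefl (A true 0F)       = refl
  adjᵛ-irrefl (A true (suc i))  = refl
  adjᵛ-irrefl C                 = refl
  adjᵛ-irrefl (E false u)       = refl
  adjᵛ-irrefl (E true u)        = refl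

  ~⇒adjᵛ : ∀ {v w} → v ~ w → adjᵛ v w ≡ true
  ~⇒adjᵛ {v} {w} (inj₁ vw) rewrite edge-complete vw = refl
  ~⇒adjᵛ {v} {w} (inj₂ wv) rewrite edge-complete wv = ∨-zeroʳ (edge v w)

  adjᵛ⇒~ : ∀ {v w} → adjᵛ v w ≡ true → v ~ w
  adjᵛ⇒~ {v} {w} h with edge v w in vw
  ... | true  = inj₁ (edge-sound v w vw)
  ... | false = inj₂ (edge-sound w v h)

  open WithAdjacency adjᵛ adjᵛ-sym adjᵛ-irrefl

  G : Graph N
  G = graph

  -- The unique rung neighbour of a vertex other than X; foot X is junk.
  foot : V → V
  foot X       = X
  foot (R s i) = R (not s) i
  foot (A s i) = R s i
  foot C       = R true 0F
  foot (E s u) = R s 1F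

  ~foot : ∀ {v} → v ≢ X → v ~ foot v
  ~foot {X}         v≢X = ⊥-elim (v≢X refl)
  ~foot {R false i} _   = inj₁ (R─R i)
  ~foot {R true i}  _   = inj₂ (R─R i)
  ~foot {A s i}     _   = inj₁ (A─R s i)
  ~foot {C}         _   = inj₁ C─R
  ~foot {E s u}     _   = inj₁ (E─R s u)

  ~R⇒foot : ∀ {v s i} → v ~ R s i → foot v ≡ R s i
  ~R⇒foot (inj₁ (R─R i))   = refl
  ~R⇒foot (inj₁ (A─R s i)) = refl
  ~R⇒foot (inj₁ C─R)       = refl
  ~R⇒foot (inj₁ (E─R s u)) = refl
  ~R⇒foot (inj₂ (R─R i))   = refl

  unique-R-neighbour : ∀ {v s i s′ i′} → v ~ R s i → v ~ R s′ i′ → R s i ≡ R s′ i′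
  unique-R-neighbour v~ v~′ = trans (sym (~R⇒foot v~)) (~R⇒foot v~′)

  -- Degrees

  two-neighbours : ∀ v → ∃ λ w → ∃ λ w′ → w ≢ w′ × v ~ w × v ~ w′
  two-neighbours X           = A false 0F , A true 0F , (λ ()) , inj₁ (X─A false 0F) , inj₁ (X─A true 0F)
  two-neighbours (R false i) = A false i , R true i , (λ ()) , inj₂ (A─R false i) , inj₁ (R─R i)
  two-neighbours (R true i)  = A true i , R false i , (λ ()) , inj₂ (A─R true i) , inj₂ (R─R i)
  two-neighbours (A s i)     = X , R s i , (λ ()) , inj₂ (X─A s i) , inj₁ (A─R s i)
  two-neighbours C           = X , R true 0F , (λ ()) , inj₂ X─C , inj₁ C─R
  two-neighbours (E s u)     = X , R s 1F , (λ ()) , inj₂ (X─E s u) , inj₁ (E─R s u)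

  G-no-isolated : NoIsolated G
  G-no-isolated i with w , _ , _ , ~w , _ ← two-neighbours (dec i) = enc w , adjᵛ⇒Adj {i} (~⇒adjᵛ ~w)

  G-min-degree : MinDegree≥ G 2
  G-min-degree i with w , w′ , w≢w′ , ~w , ~w′ ← two-neighbours (dec i) =
    2≤deg G {i} (w≢w′ ∘ enc-injective) (adjᵛ⇒Adj {i} (~⇒adjᵛ ~w)) (adjᵛ⇒Adj {i} (~⇒adjᵛ ~w′))

  Δ : ℕ
  Δ = (J + J) + suc (t + t)

  hub-degree : countᵛ (adjᵛ X) ≡ Δ
  hub-degree = trans (countᵛ-split (adjᵛ X))
    (cong₂ _+_ (count-pairs-false (adjᵛ X) R λ { false _ → refl ; true _ → refl })
               (cong₂ _+_ (count-pairs-true (adjᵛ X) A (λ _ _ → refl))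
                          (cong suc (count-pairs-true (adjᵛ X) E (λ _ _ → refl)))))

  rIndex aIndex aIndex′ : V → Fin J
  rIndex X       = 0F
  rIndex (R _ i) = i
  rIndex (A _ i) = i
  rIndex C       = 0F
  rIndex (E _ _) = 1F
  aIndex X            = 0F
  aIndex (R _ i)      = i
  aIndex (A _ (suc _)) = 0F
  aIndex (A false 0F) = 1F
  aIndex (A true 0F)  = 2F
  aIndex C            = 3F
  aIndex (E _ _)      = 0F
  aIndex′ (E _ _) = 1F
  aIndex′ v       = aIndex v

  coarse-nbhd : V → V → Bool
  coarse-nbhd v X       = true
  coarse-nbhd v (R _ j) = does (j ≟ rIndex v)
  coarse-nbhd v (A _ j) = does (j ≟ aIndex v) ∨ does (j ≟ aIndex′ v)
  coarse-nbhd v C       = true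
  coarse-nbhd v (E _ _) = true

  ~⇒coarse-nbhd : ∀ {v w} → v ≢ X → v ~ w → coarse-nbhd v w ≡ true
  ~⇒coarse-nbhd v≢X (inj₁ (X─A s i)) = ⊥-elim (v≢X refl)
  ~⇒coarse-nbhd v≢X (inj₁ X─C)       = ⊥-elim (v≢X refl)
  ~⇒coarse-nbhd v≢X (inj₁ (X─E s u)) = ⊥-elim (v≢X refl)
  ~⇒coarse-nbhd _ (inj₁ (R─R i))     = dec-true (i ≟ i) refl
  ~⇒coarse-nbhd _ (inj₁ (A─R s i))   = dec-true (i ≟ i) refl
  ~⇒coarse-nbhd _ (inj₁ C─R)         = refl
  ~⇒coarse-nbhd _ (inj₁ (E─R s u))   = refl
  ~⇒coarse-nbhd _ (inj₁ (A₀─A₁ s))   = refl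
  ~⇒coarse-nbhd _ (inj₁ (A₀─E s u))  = refl
  ~⇒coarse-nbhd _ (inj₁ (A₁─E u))    = refl
  ~⇒coarse-nbhd _ (inj₁ (A₀′─A₂ s))  = refl
  ~⇒coarse-nbhd _ (inj₁ (C─A₃ s))    = refl
  ~⇒coarse-nbhd _ (inj₁ (E─A₁′ u))   = refl
  ~⇒coarse-nbhd _ (inj₁ (E─E _))     = refl
  ~⇒coarse-nbhd _ (inj₂ (X─A s i))   = refl
  ~⇒coarse-nbhd _ (inj₂ X─C)         = refl
  ~⇒coarse-nbhd _ (inj₂ (X─E s u))   = refl
  ~⇒coarse-nbhd _ (inj₂ (R─R i))     = dec-true (i ≟ i) refl
  ~⇒coarse-nbhd _ (inj₂ (A─R s i))   rewrite dec-true (i ≟ i) refl = refl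
  ~⇒coarse-nbhd _ (inj₂ C─R)         = refl
  ~⇒coarse-nbhd _ (inj₂ (E─R s u))   = refl
  ~⇒coarse-nbhd _ (inj₂ (A₀─A₁ s))   = refl
  ~⇒coarse-nbhd _ (inj₂ (A₀─E s u))  = refl
  ~⇒coarse-nbhd _ (inj₂ (A₁─E u))    = refl
  ~⇒coarse-nbhd _ (inj₂ (A₀′─A₂ s))  = refl
  ~⇒coarse-nbhd _ (inj₂ (C─A₃ s))    = refl
  ~⇒coarse-nbhd _ (inj₂ (E─A₁′ u))   = refl
  ~⇒coarse-nbhd _ (inj₂ (E─E _))     = refl

  coarse-nbhd-size : ∀ v → countᵛ (coarse-nbhd v) ≤ 8 + (t + t)
  coarse-nbhd-size v = begin
    countᵛ (coarse-nbhd v)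
      ≡⟨ countᵛ-split (coarse-nbhd v) ⟩
    1 + (count (coarse-nbhd v ∘ pairs R) + (count (coarse-nbhd v ∘ pairs A) + (1 + count (coarse-nbhd v ∘ pairs E))))
      ≤⟨ s≤s (+-mono-≤ R-part (+-mono-≤ A-part (s≤s (≤-reflexive E-part)))) ⟩
    1 + (2 + (4 + (1 + (t + t))))
      ∎
    where
    open ≤-Reasoning
    two-indices : count (λ j → does (j ≟ aIndex v) ∨ does (j ≟ aIndex′ v)) ≤ 2
    two-indices = ≤-trans (count-∨ (λ j → does (j ≟ aIndex v)) (λ j → does (j ≟ aIndex′ v)))
                          (≤-reflexive (cong₂ _+_ (count-≟ (aIndex v)) (count-≟ (aIndex′ v))))
    R-part : count (coarse-nbhd v ∘ pairs R) ≤ 2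
    R-part = ≤-reflexive (trans (count-pairs (coarse-nbhd v) R)
                                (cong₂ _+_ (count-≟ (rIndex v)) (count-≟ (rIndex v))))
    A-part : count (coarse-nbhd v ∘ pairs A) ≤ 4
    A-part = ≤-trans (≤-reflexive (count-pairs (coarse-nbhd v) A)) (+-mono-≤ two-indices two-indices)
    E-part : count (coarse-nbhd v ∘ pairs E) ≡ t + t
    E-part = count-pairs-true (coarse-nbhd v) E (λ _ _ → refl)

  8+2t≤Δ : 8 + (t + t) ≤ Δ
  8+2t≤Δ = +-mono-≤ (+-mono-≤ (m≤m+n 4 k) (m≤m+n 4 k)) (n≤1+n (t + t))

  non-hub-degree≤Δ : ∀ {v} → v ≢ X → countᵛ (adjᵛ v) ≤ Δ
  non-hub-degree≤Δ {v} v≢X =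
    ≤-trans (countᵛ-mono {adjᵛ v} (λ w → ~⇒coarse-nbhd v≢X ∘ adjᵛ⇒~ {v} {w}))
            (≤-trans (coarse-nbhd-size v) 8+2t≤Δ)

  degree≤Δ : ∀ v → countᵛ (adjᵛ v) ≤ Δ
  degree≤Δ X         = ≤-reflexive hub-degree
  degree≤Δ v@(R _ _) = non-hub-degree≤Δ {v} (λ ())
  degree≤Δ v@(A _ _) = non-hub-degree≤Δ {v} (λ ())
  degree≤Δ v@C       = non-hub-degree≤Δ {v} (λ ())
  degree≤Δ v@(E _ _) = non-hub-degree≤Δ {v} (λ ())

  G-max-degree : MaxDegree G Δ
  G-max-degree = (λ i → subst (_≤ Δ) (sym (deg-graph i)) (degree≤Δ (dec i)))
               , zero , trans (deg-graph zero) hub-degree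

  -- Total domination number

  ~rung : ∀ s i → R (not s) i ~ R s i
  ~rung false i = inj₂ (R─R i)
  ~rung true  i = inj₁ (R─R i)

  X≁R : ∀ {s i} → ¬ X ~ R s i
  X≁R (inj₁ ())
  X≁R (inj₂ ())

  isR : V → Bool
  isR (R _ _) = true
  isR _       = false

  countᵛ-isR : countᵛ isR ≡ J + J
  countᵛ-isR = trans (countᵛ-split isR)
    (trans (cong₂ _+_ (count-pairs-true isR R (λ _ _ → refl))
                      (cong₂ _+_ (count-pairs-false isR A (λ _ _ → refl))
                                 (count-pairs-false isR E (λ _ _ → refl))))
           (+-identityʳ (J + J)))

  R-dominators-bound : (T : V → Bool) (c : V → V) → (∀ s i → c (R s i) ∈ᵛ T × c (R s i) ~ R s i) →
                       ∀ {e} → e ∈ᵛ T → (∀ s i → e ≢ c (R s i)) → suc (J + J) ≤ countᵛ T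
  R-dominators-bound T c c-dominates {e} e∈T e-new = begin
    suc (J + J)                 ≡⟨ cong suc countᵛ-isR ⟨
    suc (countᵛ isR)            ≤⟨ s≤s (countᵛ-injection c {g = remove e T} maps injective) ⟩
    suc (countᵛ (remove e T))   ≡⟨ countᵛ-remove {e} {T} e∈T ⟨
    countᵛ T                    ∎
    where
    open ≤-Reasoning
    maps : ∀ v → v ∈ᵛ isR → c v ∈ᵛ remove e T
    maps (R s i) _ = remove-keep (proj₁ (c-dominates s i)) (e-new s i ∘ sym)
    injective : ∀ {v w} → v ∈ᵛ isR → w ∈ᵛ isR → c v ≡ c w → v ≡ w
    injective {R s i} {R s′ i′} _ _ e =
      unique-R-neighbour (proj₂ (c-dominates s i)) (subst (_~ R s′ i′) (sym e) (proj₂ (c-dominates s′ i′)))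

  -- The neighbour of both A false p and A true p other than X, or X if there is none.
  owner : Fin J → V
  owner 1F = A false 0F
  owner 2F = A true 0F
  owner 3F = C
  owner _  = X

  module LowerBound (T : V → Bool) (dominated : ∀ v → Dominated T v) where

    dominator : ∀ v → ∃ λ w → w ∈ᵛ T × v ~ w
    dominator v with w , w∈T , vw ← dominated v = w , w∈T , adjᵛ⇒~ vw

    d : V → V
    d v = proj₁ (dominator v)

    d∈T : ∀ v → d v ∈ᵛ T
    d∈T v = proj₁ (proj₂ (dominator v))

    d~ : ∀ v → d v ~ v
    d~ v = ~-sym (proj₂ (proj₂ (dominator v)))

    -- T contains a dominator of each rung, all distinct; a surplus is an element beyond them.
    Surplus : Set
    Surplus = X ∈ᵛ T ⊎ ∃₂ λ s i → ∃₂ λ u w → u ∈ᵛ T × w ∈ᵛ T × u ≢ w × u ~ R s i × w ~ R s i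

    shared : ∀ {s i u w} → u ∈ᵛ T → w ∈ᵛ T → u ≢ w → u ~ R s i → w ~ R s i → Surplus
    shared u∈T w∈T u≢w u~ w~ = inj₂ (_ , _ , _ , _ , u∈T , w∈T , u≢w , u~ , w~)

    A∈T⇒surplus⊎owner∈T : ∀ {s p} → A s (suc p) ∈ᵛ T → Surplus ⊎ owner (suc p) ∈ᵛ T
    A∈T⇒surplus⊎owner∈T {false} {p} a∈T with dominator (A true (suc p))
    ... | _ , w∈T , inj₁ (A─R true _)  = inj₁ (shared a∈T w∈T (λ ()) (inj₁ (A─R false (suc p))) (~rung false (suc p)))
    ... | _ , w∈T , inj₂ (X─A true _)  = inj₁ (inj₁ w∈T)
    ... | _ , w∈T , inj₂ (A₀─A₁ true)  = inj₂ w∈T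
    ... | _ , w∈T , inj₂ (A₀′─A₂ true) = inj₂ w∈T
    ... | _ , w∈T , inj₂ (C─A₃ true)   = inj₂ w∈T
    ... | _ , w∈T , inj₂ (E─A₁′ u)     = inj₁ (shared a∈T w∈T (λ ()) (inj₁ (A─R false 1F)) (inj₁ (E─R false u)))
    A∈T⇒surplus⊎owner∈T {true} {p} a∈T with dominator (A false (suc p))
    ... | _ , w∈T , inj₁ (A─R false _)  = inj₁ (shared a∈T w∈T (λ ()) (inj₁ (A─R true (suc p))) (~rung true (suc p)))
    ... | _ , w∈T , inj₁ (A₁─E u)       = inj₁ (shared a∈T w∈T (λ ()) (inj₁ (A─R true 1F)) (inj₁ (E─R true u)))
    ... | _ , w∈T , inj₂ (X─A false _)  = inj₁ (inj₁ w∈T)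
    ... | _ , w∈T , inj₂ (A₀─A₁ false)  = inj₂ w∈T
    ... | _ , w∈T , inj₂ (A₀′─A₂ false) = inj₂ w∈T
    ... | _ , w∈T , inj₂ (C─A₃ false)   = inj₂ w∈T

    E∈T⇒surplus⊎A₀∈T : ∀ {s u} → E s u ∈ᵛ T → Surplus ⊎ A false 0F ∈ᵛ T
    E∈T⇒surplus⊎A₀∈T {false} {u} e∈T with dominator (E true u)
    ... | _ , w∈T , inj₁ (E─R true _)  = inj₁ (shared e∈T w∈T (λ ()) (inj₁ (E─R false u)) (~rung false 1F))
    ... | _ , w∈T , inj₂ (X─E true _)  = inj₁ (inj₁ w∈T)
    ... | _ , w∈T , inj₂ (A₀─E true _) = inj₂ w∈T
    ... | _ , w∈T , inj₂ (A₁─E _)      = inj₁ (shared e∈T w∈T (λ ()) (inj₁ (E─R false u)) (inj₁ (A─R false 1F)))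
    ... | _ , w∈T , inj₂ (E─E u′≢u)    =
      inj₁ (shared e∈T w∈T (λ { refl → u′≢u refl }) (inj₁ (E─R false u)) (inj₁ (E─R false _)))
    E∈T⇒surplus⊎A₀∈T {true} {u} e∈T with dominator (E false u)
    ... | _ , w∈T , inj₁ (E─R false _)  = inj₁ (shared e∈T w∈T (λ ()) (inj₁ (E─R true u)) (~rung true 1F))
    ... | _ , w∈T , inj₁ (E─A₁′ _)      = inj₁ (shared e∈T w∈T (λ ()) (inj₁ (E─R true u)) (inj₁ (A─R true 1F)))
    ... | _ , w∈T , inj₁ (E─E u≢u′)     =
      inj₁ (shared e∈T w∈T (λ { refl → u≢u′ refl }) (inj₁ (E─R true u)) (inj₁ (E─R true _)))
    ... | _ , w∈T , inj₂ (X─E false _)  = inj₁ (inj₁ w∈T)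
    ... | _ , w∈T , inj₂ (A₀─E false _) = inj₂ w∈T

    A₀∈T⇒R₀′∈T⇒surplus : A false 0F ∈ᵛ T → R true 0F ∈ᵛ T → Surplus
    A₀∈T⇒R₀′∈T⇒surplus a∈T r∈T = shared a∈T r∈T (λ ()) (inj₁ (A─R false 0F)) (inj₂ (R─R 0F))

    R₀′∈T⇒surplus : ∀ {y} → y ∈ᵛ T → y ~ R true 0F → y ≢ R false 0F → R true 0F ∈ᵛ T → Surplus
    R₀′∈T⇒surplus y∈T y~ y≢R₀ r∈T with dominator (A false 0F)
    ... | _ , w∈T , inj₁ (A─R false 0F) = shared y∈T w∈T y≢R₀ y~ (inj₁ (R─R 0F))
    ... | _ , w∈T , inj₁ (A₀─A₁ s)      = [ id , (λ a∈T → A₀∈T⇒R₀′∈T⇒surplus a∈T r∈T) ]′ (A∈T⇒surplus⊎owner∈T w∈T)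
    ... | _ , w∈T , inj₁ (A₀─E s u)     = [ id , (λ a∈T → A₀∈T⇒R₀′∈T⇒surplus a∈T r∈T) ]′ (E∈T⇒surplus⊎A₀∈T w∈T)
    ... | _ , w∈T , inj₂ (X─A false 0F) = inj₁ w∈T

    A₀′∈T⇒surplus : A true 0F ∈ᵛ T → Surplus
    A₀′∈T⇒surplus a∈T with dominator C
    ... | _ , w∈T , inj₁ C─R      = R₀′∈T⇒surplus a∈T (inj₁ (A─R true 0F)) (λ ()) w∈T
    ... | _ , w∈T , inj₁ (C─A₃ s) =
      [ id , (λ c∈T → shared a∈T c∈T (λ ()) (inj₁ (A─R true 0F)) (inj₁ C─R)) ]′ (A∈T⇒surplus⊎owner∈T w∈T)
    ... | _ , w∈T , inj₂ X─C      = inj₁ w∈T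

    C∈T⇒surplus : C ∈ᵛ T → Surplus
    C∈T⇒surplus c∈T with dominator (A true 0F)
    ... | _ , w∈T , inj₁ (A─R true 0F) = R₀′∈T⇒surplus c∈T (inj₁ C─R) (λ ()) w∈T
    ... | _ , w∈T , inj₁ (A₀′─A₂ s)    =
      [ id , (λ a∈T → shared a∈T c∈T (λ ()) (inj₁ (A─R true 0F)) (inj₁ C─R)) ]′ (A∈T⇒surplus⊎owner∈T w∈T)
    ... | _ , w∈T , inj₂ (X─A true 0F) = inj₁ w∈T

    A₀∈T⇒surplus : A false 0F ∈ᵛ T → Surplus
    A₀∈T⇒surplus a∈T with dominator (A true 0F)
    ... | _ , w∈T , inj₁ (A─R true 0F) = A₀∈T⇒R₀′∈T⇒surplus a∈T w∈T
    ... | _ , w∈T , inj₁ (A₀′─A₂ s)    = [ id , A₀′∈T⇒surplus ]′ (A∈T⇒surplus⊎owner∈T w∈T)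
    ... | _ , w∈T , inj₂ (X─A true 0F) = inj₁ w∈T

    owner∈T⇒surplus : ∀ p → owner (suc p) ∈ᵛ T → Surplus
    owner∈T⇒surplus 0F                  = A₀∈T⇒surplus
    owner∈T⇒surplus 1F                  = A₀′∈T⇒surplus
    owner∈T⇒surplus 2F                  = C∈T⇒surplus
    owner∈T⇒surplus (suc (suc (suc _))) = inj₁

    surplus : Surplus
    surplus with dominator X
    ... | _ , w∈T , inj₁ (X─A false 0F)  = A₀∈T⇒surplus w∈T
    ... | _ , w∈T , inj₁ (X─A true 0F)   = A₀′∈T⇒surplus w∈T
    ... | _ , w∈T , inj₁ (X─A s (suc p)) = [ id , owner∈T⇒surplus p ]′ (A∈T⇒surplus⊎owner∈T w∈T)
    ... | _ , w∈T , inj₁ X─C             = C∈T⇒surplus w∈T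
    ... | _ , w∈T , inj₁ (X─E s u)       = [ id , A₀∈T⇒surplus ]′ (E∈T⇒surplus⊎A₀∈T w∈T)

    surplus⇒bound : Surplus → suc (J + J) ≤ countᵛ T
    surplus⇒bound (inj₁ X∈T) =
      R-dominators-bound T d (λ s i → d∈T (R s i) , d~ (R s i)) X∈T
                         (λ s i X≡d → X≁R (subst (_~ R s i) (sym X≡d) (d~ (R s i))))
    surplus⇒bound (inj₂ (s₀ , i₀ , u , w , u∈T , w∈T , u≢w , u~ , w~)) =
      R-dominators-bound T c c-dominates w∈T w-new
      where
      c : V → V
      c v with v ≟ᵛ R s₀ i₀
      ... | yes _    = u
      ... | no  _    = d v
      c-dominates : ∀ s i → c (R s i) ∈ᵛ T × c (R s i) ~ R s i
      c-dominates s i with R s i ≟ᵛ R s₀ i₀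
      ... | yes refl = u∈T , u~
      ... | no  _    = d∈T (R s i) , d~ (R s i)
      w-new : ∀ s i → w ≢ c (R s i)
      w-new s i with R s i ≟ᵛ R s₀ i₀
      ... | yes _    = u≢w ∘ sym
      ... | no  r≢r₀ = λ w≡d → r≢r₀ (unique-R-neighbour (subst (_~ R s i) (sym w≡d) (d~ (R s i))) w~)

  γt≥ : ∀ S → IsTDS G S → suc (J + J) ≤ ∣ S ∣
  γt≥ S tds = subst (suc (J + J) ≤_) (sym (∣S∣≡countᵛ S)) (surplus⇒bound surplus)
    where open LowerBound (lookup S ∘ enc) (IsTDS⇒Dominated tds)

  ~⇒Dominated : ∀ {T u w} → w ∈ᵛ T → u ~ w → Dominated T u
  ~⇒Dominated w∈T u~w = _ , w∈T , ~⇒adjᵛ u~w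

  foot-isR : ∀ {v} → v ≢ X → foot v ∈ᵛ isR
  foot-isR {X}     v≢X = ⊥-elim (v≢X refl)
  foot-isR {R _ _} _   = refl
  foot-isR {A _ _} _   = refl
  foot-isR {C}     _   = refl
  foot-isR {E _ _} _   = refl

  foot-dominates : ∀ {T} u → u ≢ X → foot u ∈ᵛ T → Dominated T u
  foot-dominates u u≢X foot∈T = ~⇒Dominated foot∈T (~foot {u} u≢X)

  R∪C : V → Bool
  R∪C = insert C isR

  R∪C-dominates : ∀ u → Dominated R∪C u
  R∪C-dominates u with u ≟ᵛ X
  ... | yes refl = ~⇒Dominated insert-new (inj₁ X─C)
  ... | no  u≢X  = foot-dominates u u≢X (insert-keep (foot-isR u≢X))

  G-γt : γt≡ G (suc (J + J))
  G-γt = (tabulate (R∪C ∘ dec) , R∪C-TDS , ≤-antisym size (γt≥ _ R∪C-TDS)) , γt≥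
    where
    R∪C-TDS : IsTDS G (tabulate (R∪C ∘ dec))
    R∪C-TDS = tabulate-IsTDSᵛ R∪C R∪C-dominates
    size : ∣ tabulate (R∪C ∘ dec) ∣ ≤ suc (J + J)
    size = ≤-trans (≤-reflexive (∣tabulate∣≡count (R∪C ∘ dec)))
                   (≤-trans (countᵛ-insert C isR) (s≤s (≤-reflexive countᵛ-isR)))

  -- Vertex deletion

  record DeletionSet (x : V) : Set where
    field
      set       : V → Bool
      excludes  : set x ≡ false
      dominates : ∀ u → u ≢ x → Dominated set u
      small     : countᵛ set ≤ J + J

  delete-X : DeletionSet X
  delete-X = record
    { set       = isR
    ; excludes  = refl
    ; dominates = λ u u≢X → foot-dominates u u≢X (foot-isR u≢X)
    ; small     = ≤-reflexive countᵛ-isR }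

  R-flip : ∀ {s s′ i i′} → R (not s′) i′ ≡ R s i → R s′ i′ ≡ R (not s) i
  R-flip {false} {true}  refl = refl
  R-flip {true}  {false} refl = refl

  R-not-injective : ∀ {s s′ i i′} → R (not s′) i′ ≡ R (not s) i → R s′ i′ ≡ R s i
  R-not-injective {false} {false} refl = refl
  R-not-injective {true}  {true}  refl = refl

  R≢R-not : ∀ s {i} → R s i ≢ R (not s) i
  R≢R-not false ()
  R≢R-not true  ()

  delete-R : ∀ s i → DeletionSet (R s i)
  delete-R s i = record { set = T ; excludes = replace-old (λ ()) ; dominates = dominates ; small = small }
    where
    T′ T : V → Bool
    T′ = replace (R (not s) i) (A (not s) i) isR
    T  = replace (R s i) X T′
    A∈T : A (not s) i ∈ᵛ T
    A∈T = replace-keep replace-new (λ ())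
    small : countᵛ T ≤ J + J
    small = ≤-trans (countᵛ-replace (replace-keep refl (R≢R-not s)))
                    (≤-trans (countᵛ-replace refl) (≤-reflexive countᵛ-isR))
    dominates : ∀ u → u ≢ R s i → Dominated T u
    dominates X         _ = ~⇒Dominated A∈T (inj₁ (X─A (not s) i))
    dominates (R s′ i′) u≢R with R s′ i′ ≟ᵛ R (not s) i
    ... | yes refl = ~⇒Dominated A∈T (inj₂ (A─R (not s) i))
    ... | no  u≢R′ = foot-dominates (R s′ i′) (λ ())
                        (replace-keep (replace-keep refl (u≢R ∘ R-not-injective)) (u≢R′ ∘ R-flip))
    dominates (A s′ i′) _ = ~⇒Dominated replace-new (inj₂ (X─A s′ i′))
    dominates C         _ = ~⇒Dominated replace-new (inj₂ X─C)
    dominates (E s′ u)  _ = ~⇒Dominated replace-new (inj₂ (X─E s′ u))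

  foot-foot-R : ∀ s i → foot (foot (R s i)) ≡ R s i
  foot-foot-R s i = cong (λ b → R b i) (not-involutive s)

  -- G - x is dominated by the rungs with foot x exchanged for its twin y.
  module Twin {x y : V} (x∉R : isR x ≡ false) (x≢X : x ≢ X) (x≢y : x ≢ y) (X~y : X ~ y)
              (y~rung : y ~ foot (foot x))
              (twin : ∀ {u} → u ≢ x → u ≢ X → isR u ≡ false → foot u ≡ foot x → u ~ y) where

    T : V → Bool
    T = replace (foot x) y isR

    foot-or-y : ∀ u → u ≢ X → (foot u ≡ foot x → u ~ y) → Dominated T u
    foot-or-y u u≢X u~y with foot u ≟ᵛ foot x
    ... | yes same = ~⇒Dominated replace-new (u~y same)
    ... | no  diff = foot-dominates u u≢X (replace-keep (foot-isR u≢X) diff)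

    deletion-set : DeletionSet x
    deletion-set = record
      { set       = T
      ; excludes  = replace-absent x∉R x≢y
      ; dominates = dominates
      ; small     = ≤-trans (countᵛ-replace (foot-isR x≢X)) (≤-reflexive countᵛ-isR) }
      where
      dominates : ∀ u → u ≢ x → Dominated T u
      dominates X         _   = ~⇒Dominated replace-new X~y
      dominates (R s i)   _   = foot-or-y (R s i) (λ ()) λ same →
        subst (_~ y) (trans (cong foot (sym same)) (foot-foot-R s i)) (~-sym y~rung)
      dominates u@(A _ _) u≢x = foot-or-y u (λ ()) (twin u≢x (λ ()) refl)
      dominates u@C       u≢x = foot-or-y u (λ ()) (twin u≢x (λ ()) refl)
      dominates u@(E _ _) u≢x = foot-or-y u (λ ()) (twin u≢x (λ ()) refl)

  twin-A₀ : ∀ {u} → u ≢ A false 0F → u ≢ X → isR u ≡ false → foot u ≡ R false 0F → u ~ A true 0F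
  twin-A₀ {A false 0F} u≢x _ _ refl = ⊥-elim (u≢x refl)

  twin-A : ∀ s p {u} → u ≢ A s (suc p) → u ≢ X → isR u ≡ false → foot u ≡ R s (suc p) →
           u ~ A (not s) (suc p)
  twin-A s     p  {A s (suc p)} u≢x _ _ refl = ⊥-elim (u≢x refl)
  twin-A false 0F {E false u}   _   _ _ refl = inj₁ (E─A₁′ u)
  twin-A true  0F {E true u}    _   _ _ refl = inj₂ (A₁─E u)

  twin-E : ∀ s u {w} → w ≢ E s u → w ≢ X → isR w ≡ false → foot w ≡ R s 1F → w ~ E (not s) u
  twin-E false u {A false 1F} _   _ _ refl = inj₁ (A₁─E u)
  twin-E true  u {A true 1F}  _   _ _ refl = inj₂ (E─A₁′ u)
  twin-E false u {E false u′} w≢x _ _ refl = inj₁ (E─E λ { refl → w≢x refl })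
  twin-E true  u {E true u′}  w≢x _ _ refl = inj₂ (E─E λ { refl → w≢x refl })

  A≢A-not : ∀ s {i} → A s i ≢ A (not s) i
  A≢A-not false ()
  A≢A-not true  ()

  E≢E-not : ∀ s {u} → E s u ≢ E (not s) u
  E≢E-not false ()
  E≢E-not true  ()

  delete-A₀ : DeletionSet (A false 0F)
  delete-A₀ = Twin.deletion-set refl (λ ()) (λ ()) (inj₁ (X─A true 0F)) (inj₁ (A─R true 0F)) twin-A₀

  delete-A : ∀ s p → DeletionSet (A s (suc p))
  delete-A s p = Twin.deletion-set refl (λ ()) (A≢A-not s) (inj₁ (X─A (not s) (suc p)))
                                    (inj₁ (A─R (not s) (suc p))) (twin-A s p)

  delete-E : ∀ s u → DeletionSet (E s u)
  delete-E s u = Twin.deletion-set refl (λ ()) (E≢E-not s) (inj₁ (X─E (not s) u))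
                                    (inj₁ (E─R (not s) u)) (twin-E s u)

  module FourSwaps (r₁ r₂ r₃ r₄ x₁ x₂ x₃ x₄ : V) where

    T : V → Bool
    T = replace r₄ x₄ (replace r₃ x₃ (replace r₂ x₂ (replace r₁ x₁ isR)))

    keep : ∀ {w} → w ∈ᵛ isR → w ≢ r₁ → w ≢ r₂ → w ≢ r₃ → w ≢ r₄ → w ∈ᵛ T
    keep w∈R w≢r₁ w≢r₂ w≢r₃ w≢r₄ =
      replace-keep (replace-keep (replace-keep (replace-keep w∈R w≢r₁) w≢r₂) w≢r₃) w≢r₄

    x₁∈T : x₁ ≢ r₂ → x₁ ≢ r₃ → x₁ ≢ r₄ → x₁ ∈ᵛ T
    x₁∈T x₁≢r₂ x₁≢r₃ x₁≢r₄ = replace-keep (replace-keep (replace-keep replace-new x₁≢r₂) x₁≢r₃) x₁≢r₄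

    x₂∈T : x₂ ≢ r₃ → x₂ ≢ r₄ → x₂ ∈ᵛ T
    x₂∈T x₂≢r₃ x₂≢r₄ = replace-keep (replace-keep replace-new x₂≢r₃) x₂≢r₄

    x₃∈T : x₃ ≢ r₄ → x₃ ∈ᵛ T
    x₃∈T = replace-keep replace-new

    x₄∈T : x₄ ∈ᵛ T
    x₄∈T = replace-new

    absent : ∀ {w} → isR w ≡ false → w ≢ x₁ → w ≢ x₂ → w ≢ x₃ → w ≢ x₄ → T w ≡ false
    absent w∉R w≢x₁ w≢x₂ w≢x₃ w≢x₄ =
      replace-absent (replace-absent (replace-absent (replace-absent w∉R w≢x₁) w≢x₂) w≢x₃) w≢x₄

    small : r₁ ∈ᵛ isR → r₂ ∈ᵛ isR → r₃ ∈ᵛ isR → r₄ ∈ᵛ isR →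
            r₂ ≢ r₁ → r₃ ≢ r₁ → r₃ ≢ r₂ → r₄ ≢ r₁ → r₄ ≢ r₂ → r₄ ≢ r₃ → countᵛ T ≤ J + J
    small r₁∈ r₂∈ r₃∈ r₄∈ r₂≢r₁ r₃≢r₁ r₃≢r₂ r₄≢r₁ r₄≢r₂ r₄≢r₃ =
      ≤-trans (countᵛ-replace (replace-keep (replace-keep (replace-keep r₄∈ r₄≢r₁) r₄≢r₂) r₄≢r₃))
      (≤-trans (countᵛ-replace (replace-keep (replace-keep r₃∈ r₃≢r₁) r₃≢r₂))
      (≤-trans (countᵛ-replace (replace-keep r₂∈ r₂≢r₁))
      (≤-trans (countᵛ-replace r₁∈) (≤-reflexive countᵛ-isR))))

    dominated-unless-exposed : ∀ u → Dominated T X →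
      (foot u ≡ r₁ → Dominated T u) → (foot u ≡ r₂ → Dominated T u) →
      (foot u ≡ r₃ → Dominated T u) → (foot u ≡ r₄ → Dominated T u) → Dominated T u
    dominated-unless-exposed u X-dominated via₁ via₂ via₃ via₄ with u ≟ᵛ X
    ... | yes refl = X-dominated
    ... | no  u≢X with foot u ≟ᵛ r₁ | foot u ≟ᵛ r₂ | foot u ≟ᵛ r₃ | foot u ≟ᵛ r₄
    ... | yes e | _     | _     | _     = via₁ e
    ... | no _  | yes e | _     | _     = via₂ e
    ... | no _  | no _  | yes e | _     = via₃ e
    ... | no _  | no _  | no _  | yes e = via₄ e
    ... | no n₁ | no n₂ | no n₃ | no n₄ = foot-dominates u u≢X (keep (foot-isR u≢X) n₁ n₂ n₃ n₄)

  delete-A₀′ : DeletionSet (A true 0F)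
  delete-A₀′ = record
    { set       = T
    ; excludes  = absent refl (λ ()) (λ ()) (λ ()) (λ ())
    ; dominates = λ u u≢x → dominated-unless-exposed u (~⇒Dominated A₀∈T (inj₁ (X─A false 0F)))
                              (via-R₀ u) (via-R₀′ u u≢x) (via-R₁′ u) (via-R₃′ u)
    ; small     = small refl refl refl refl (λ ()) (λ ()) (λ ()) (λ ()) (λ ()) (λ ()) }
    where
    open FourSwaps (R false 0F) (R true 0F) (R true 1F) (R true 3F) (A false 0F) C (A false 1F) (A false 3F)
    A₀∈T : A false 0F ∈ᵛ T
    A₀∈T = x₁∈T (λ ()) (λ ()) (λ ())
    C∈T : C ∈ᵛ T
    C∈T = x₂∈T (λ ()) (λ ())
    A₁∈T : A false 1F ∈ᵛ T
    A₁∈T = x₃∈T (λ ())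
    via-R₀ : ∀ u → foot u ≡ R false 0F → Dominated T u
    via-R₀ (R true 0F)  refl = ~⇒Dominated C∈T (inj₂ C─R)
    via-R₀ (A false 0F) refl = ~⇒Dominated A₁∈T (inj₁ (A₀─A₁ false))
    via-R₀′ : ∀ u → u ≢ A true 0F → foot u ≡ R true 0F → Dominated T u
    via-R₀′ (R false 0F) _   refl = ~⇒Dominated A₀∈T (inj₂ (A─R false 0F))
    via-R₀′ (A true 0F)  u≢x refl = ⊥-elim (u≢x refl)
    via-R₀′ C            _   refl = ~⇒Dominated x₄∈T (inj₁ (C─A₃ false))
    via-R₁′ : ∀ u → foot u ≡ R true 1F → Dominated T u
    via-R₁′ (R false 1F) refl = ~⇒Dominated A₁∈T (inj₂ (A─R false 1F))
    via-R₁′ (A true 1F)  refl = ~⇒Dominated A₀∈T (inj₂ (A₀─A₁ true))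
    via-R₁′ (E true v)   refl = ~⇒Dominated A₀∈T (inj₂ (A₀─E true v))
    via-R₃′ : ∀ u → foot u ≡ R true 3F → Dominated T u
    via-R₃′ (R false 3F) refl = ~⇒Dominated x₄∈T (inj₂ (A─R false 3F))
    via-R₃′ (A true 3F)  refl = ~⇒Dominated C∈T (inj₂ (C─A₃ true))

  delete-C : DeletionSet C
  delete-C = record
    { set       = T
    ; excludes  = absent refl (λ ()) (λ ()) (λ ()) (λ ())
    ; dominates = λ u u≢x → dominated-unless-exposed u (~⇒Dominated A₀∈T (inj₁ (X─A false 0F)))
                              (via-R₀ u) (via-R₀′ u u≢x) (via-R₁′ u) (via-R₂′ u)
    ; small     = small refl refl refl refl (λ ()) (λ ()) (λ ()) (λ ()) (λ ()) (λ ()) }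
    where
    open FourSwaps (R false 0F) (R true 0F) (R true 1F) (R true 2F) (A false 0F) (A true 0F) (A false 1F) (A false 2F)
    A₀∈T : A false 0F ∈ᵛ T
    A₀∈T = x₁∈T (λ ()) (λ ()) (λ ())
    A₀′∈T : A true 0F ∈ᵛ T
    A₀′∈T = x₂∈T (λ ()) (λ ())
    A₁∈T : A false 1F ∈ᵛ T
    A₁∈T = x₃∈T (λ ())
    via-R₀ : ∀ u → foot u ≡ R false 0F → Dominated T u
    via-R₀ (R true 0F)  refl = ~⇒Dominated A₀′∈T (inj₂ (A─R true 0F))
    via-R₀ (A false 0F) refl = ~⇒Dominated A₁∈T (inj₁ (A₀─A₁ false))
    via-R₀′ : ∀ u → u ≢ C → foot u ≡ R true 0F → Dominated T u
    via-R₀′ (R false 0F) _   refl = ~⇒Dominated A₀∈T (inj₂ (A─R false 0F))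
    via-R₀′ (A true 0F)  _   refl = ~⇒Dominated x₄∈T (inj₁ (A₀′─A₂ false))
    via-R₀′ C            u≢x refl = ⊥-elim (u≢x refl)
    via-R₁′ : ∀ u → foot u ≡ R true 1F → Dominated T u
    via-R₁′ (R false 1F) refl = ~⇒Dominated A₁∈T (inj₂ (A─R false 1F))
    via-R₁′ (A true 1F)  refl = ~⇒Dominated A₀∈T (inj₂ (A₀─A₁ true))
    via-R₁′ (E true v)   refl = ~⇒Dominated A₀∈T (inj₂ (A₀─E true v))
    via-R₂′ : ∀ u → foot u ≡ R true 2F → Dominated T u
    via-R₂′ (R false 2F) refl = ~⇒Dominated x₄∈T (inj₂ (A─R false 2F))
    via-R₂′ (A true 2F)  refl = ~⇒Dominated A₀′∈T (inj₂ (A₀′─A₂ true))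

  deletion-set : ∀ x → DeletionSet x
  deletion-set X             = delete-X
  deletion-set (R s i)       = delete-R s i
  deletion-set (A false 0F)  = delete-A₀
  deletion-set (A true 0F)   = delete-A₀′
  deletion-set (A s (suc p)) = delete-A s p
  deletion-set C             = delete-C
  deletion-set (E s u)       = delete-E s u

  -- G has no leaves, so every vertex must satisfy the deletion condition.
  G-deletion : DeletionCondition (suc (J + J)) G
  G-deletion v _ = delete-γt< G v (set ∘ dec) excludes
                     (λ i i≢v → Dominated⇒Adj {set} {i} (dominates (dec i) (i≢v ∘ dec-injective)))
                     (s≤s small)
    where open DeletionSet (deletion-set (dec v))

  G-critical : mγtCritical (suc (J + J)) G × MaxDegree G Δ × MinDegree≥ G 2
  G-critical = (G-no-isolated , G-γt , G-deletion) , G-max-degree , G-min-degree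

CriticalGraph : ℕ → ℕ → ℕ → Set
CriticalGraph n Δ m = Σ (Graph n) λ G → mγtCritical m G × MaxDegree G Δ × MinDegree≥ G 2

CriticalGraph-cast : ∀ {n n′ Δ Δ′ m m′} → n ≡ n′ → Δ ≡ Δ′ → m ≡ m′ →
                     CriticalGraph n Δ m → CriticalGraph n′ Δ′ m′
CriticalGraph-cast refl refl refl G = G

-- Stated with 1 + _ : solve-∀ cannot quote the constructor suc while it is overloaded with Fin.suc.
order-eq : ∀ j t → 1 + ((j + j) + ((j + j) + (1 + (t + t)))) ≡ (1 + 2 * (j + t)) + (1 + 2 * j)
order-eq = solve-∀

max-degree-eq : ∀ j t → (j + j) + (1 + (t + t)) ≡ 1 + 2 * (j + t)
max-degree-eq = solve-∀

γt-eq : ∀ j → 1 + (j + j) ≡ 1 + 2 * j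
γt-eq = solve-∀

critical-graph : ∀ k t → CriticalGraph (suc (2 * (4 + k + t)) + suc (2 * (4 + k)))
                                       (suc (2 * (4 + k + t))) (suc (2 * (4 + k)))
critical-graph k t =
  CriticalGraph-cast (order-eq (4 + k) t) (max-degree-eq (4 + k) t) (γt-eq (4 + k)) (G , G-critical)
  where open Construction k t

half-≤ : ∀ {a b} → suc (2 * a) ≤ suc (2 * b) → a ≤ b
half-≤ = *-cancelˡ-≤ 2 ∘ ≤-pred

theorem14 : (m Δ : ℕ) → Odd m → 9 ≤ m → Odd Δ → m ≤ Δ →
    Σ (Graph (Δ + m)) λ G →
      mγtCritical m G × MaxDegree G Δ × MinDegree≥ G 2
theorem14 _ _ (a , refl) 9≤m (b , refl) m≤Δ
  with k , refl ← m≤n⇒∃[o]m+o≡n (half-≤ {4} {a} 9≤m)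
     | t , refl ← m≤n⇒∃[o]m+o≡n (half-≤ {a} {b} m≤Δ)
  = critical-graph k t
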